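{- $\mathbf{PAFKy}$ and $\mathbf{ELKy^r}$ are not equally expressive (over $\mathcal{S}5$ knowing-why models); in particular, there is a formula of $\mathcal{L}_{PAFKy}$ that is not equivalent to any formula of $\mathcal{L}_{ELKy^r}$.
   Context: Fix a countable set of agents $\mathcal{A}$ and a countably infinite set of atoms $\mathcal{P}$. $\mathcal{L}_{PAFKy}$: $\phi ::= p\mid\neg\phi\mid(\phi\land\phi)\mid K_a\phi\mid Ky_a\phi\mid[\phi]\phi$; $\mathcal{L}_{ELKy^r}$: $\phi ::= p\mid\neg\phi\mid(\phi\land\phi)\mid K_a\phi\mid Ky_a^r(\phi,\phi)$. Let $\mathcal{L}$ be the set of formulas built with all these constructs. $\Lambda$ is a fixed set of valid formulas (tautology ground). An $\mathcal{S}5$ knowing-why model is $\mathfrak{M}=\langle W,E,\{R_a\}_{a\in\mathcal{A}},\mathcal{E},V\rangle$ with $W\neq\emptyset$; $E$ nonempty, containing a designated $e$, closed under a binary operation $\cdot$; each $R_a$ an equivalence relation on $W$; $\mathcal{E}:E\times\mathcal{L}\to 2^W$ with $\mathcal{E}(e,\phi)=W$ for $\phi\in\Lambda$ and $\mathcal{E}(s,\phi\to\psi)\cap\mathcal{E}(t,\phi)\subseteq\mathcal{E}(s\cdot t,\psi)$; $V:\mathcal{P}\to 2^W$. Truth: $p,\neg,\land$ as usual; $K_a\phi$ holds at $w$ iff $\phi$ holds at all $R_a$-successors; $Ky_a\phi$ holds at $w$ iff $K_a\phi$ holds at $w$ and there is $t\in E$ with $v\in\mathcal{E}(t,\phi)$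 for all $R_a$-successors $v$; $Ky_a^r(\phi,\psi)$ holds at $w$ iff there is $t\in E$ such that every $v$ with $(w,v)\in R_a$ and $(\mathfrak{M},v)\models\phi$ satisfies $v\in\mathcal{E}(t,\psi)$ and $(\mathfrak{M},v)\models\psi$; $(\mathfrak{M},w)\models[\phi]\psi$ iff $(\mathfrak{M},w)\models\phi$ implies $(\mathfrak{M}|\phi,w)\models\psi$, where $\mathfrak{M}|\phi$ restricts $W$ to $W'=\{w\mid(\mathfrak{M},w)\models\phi\}$, $R_a$ to $R_a\cap(W'\times W')$, $V(p)$ to $V(p)\cap W'$ and $\mathcal{E}(t,\chi)$ to $\mathcal{E}(t,\chi)\cap W'$, keeping $E$. Two formulas are equivalent if they hold at exactly the same pointed models. Two logics are equally expressive if every formula of each is equivalent to some formula of the other. -}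

module Defs where

open import Data.Nat using (ℕ)
open import Data.Bool using (Bool; true; false; not; _∧_)
open import Data.Product using (Σ; ∃; _×_; _,_; proj₁)
open import Data.Empty using (⊥)
open import Relation.Nullary using (¬_)
open import Relation.Binary.PropositionalEquality using (_≡_)
open import Relation.Binary.Structures using (IsEquivalence)
open import Function.Bundles using (_⇔_)

data Form (Ag : Set) : Set where
  var  : ℕ → Form Ag
  neg  : Form Ag → Form Ag
  conj : Form Ag → Form Ag → Form Ag
  K    : Ag → Form Ag → Form Ag
  Ky   : Ag → Form Ag → Form Ag
  Kyr  : Ag → Form Ag → Form Ag → Form Ag
  ann  : Form Ag → Form Ag → Form Ag      -- ann φ ψ  is  [φ]ψ

module _ {Ag : Set} where

  _⇒_ : Form Ag → Form Ag → Form Ag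
  φ ⇒ ψ = neg (conj φ (neg ψ))

  data IsPAFKy : Form Ag → Set where
    var  : ∀ p → IsPAFKy (var p)
    neg  : ∀ {φ} → IsPAFKy φ → IsPAFKy (neg φ)
    conj : ∀ {φ ψ} → IsPAFKy φ → IsPAFKy ψ → IsPAFKy (conj φ ψ)
    K    : ∀ a {φ} → IsPAFKy φ → IsPAFKy (K a φ)
    Ky   : ∀ a {φ} → IsPAFKy φ → IsPAFKy (Ky a φ)
    ann  : ∀ {φ ψ} → IsPAFKy φ → IsPAFKy ψ → IsPAFKy (ann φ ψ)

  data IsELKyr : Form Ag → Set where
    var  : ∀ p → IsELKyr (var p)
    neg  : ∀ {φ} → IsELKyr φ → IsELKyr (neg φ)
    conj : ∀ {φ ψ} → IsELKyr φ → IsELKyr ψ → IsELKyr (conj φ ψ)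
    K    : ∀ a {φ} → IsELKyr φ → IsELKyr (K a φ)
    Kyr  : ∀ a {φ ψ} → IsELKyr φ → IsELKyr ψ → IsELKyr (Kyr a φ ψ)

  -- Λ: propositional tautologies of ℒ (non-Boolean subformulas treated as atoms).
  pval : (Form Ag → Bool) → Form Ag → Bool
  pval f (neg φ)    = not (pval f φ)
  pval f (conj φ ψ) = pval f φ ∧ pval f ψ
  pval f φ          = f φ

  Λ : Form Ag → Set
  Λ φ = ∀ (f : Form Ag → Bool) → pval f φ ≡ true

  -- Raw knowing-why structure (no frame conditions); semantics is defined on these.
  record Struct : Set₁ where
    field
      W   : Set
      E   : Set
      e   : E
      _·_ : E → E → E
      R   : Ag → W → W → Set
      Ev  : E → Form Ag → W → Set      -- ℰ(t,φ) as a predicate on W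
      V   : ℕ → W → Set

  open Struct

  mutual
    _,_⊨_ : (M : Struct) → W M → Form Ag → Set
    restrict : Struct → Form Ag → Struct

    restrict M φ = record
      { W   = Σ (W M) (λ w → M , w ⊨ φ)
      ; E   = E M
      ; e   = e M
      ; _·_ = _·_ M
      ; R   = λ a u v → R M a (proj₁ u) (proj₁ v)
      ; Ev  = λ t χ u → Ev M t χ (proj₁ u)
      ; V   = λ p u → V M p (proj₁ u)
      }

    M , w ⊨ var p      = V M p w
    M , w ⊨ neg φ      = ¬ (M , w ⊨ φ)
    M , w ⊨ conj φ ψ   = (M , w ⊨ φ) × (M , w ⊨ ψ)
    M , w ⊨ K a φ      = ∀ v → R M a w v → M , v ⊨ φ
    M , w ⊨ Ky a φ     = (∀ v → R M a w v → M , v ⊨ φ)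
                         × Σ (E M) (λ t → ∀ v → R M a w v → Ev M t φ v)
    M , w ⊨ Kyr a φ ψ  = Σ (E M) (λ t → ∀ v → R M a w v → M , v ⊨ φ
                                          → Ev M t ψ v × (M , v ⊨ ψ))
    M , w ⊨ ann φ ψ    = (pf : M , w ⊨ φ) → restrict M φ , (w , pf) ⊨ ψ


  record Model : Set₁ where
    field
      str      : Struct
      nonempty : W str
      R-equiv  : ∀ a → IsEquivalence (R str a)
      Ev-Λ     : ∀ φ → Λ φ → ∀ w → Ev str (e str) φ w
      Ev-mp    : ∀ s t φ ψ w → Ev str s (φ ⇒ ψ) w → Ev str t φ w
                 → Ev str (_·_ str s t) ψ w

  open Model

  Equivalent : Form Ag → Form Ag → Set₁
  Equivalent φ ψ = ∀ (M : Model) (w : W (str M)) → (str M , w ⊨ φ) ⇔ (str M , w ⊨ ψ)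

  EquallyExpressive-PAFKy-ELKyr : Set₁
  EquallyExpressive-PAFKy-ELKyr =
    (∀ φ → IsPAFKy φ → Σ (Form Ag) (λ ψ → IsELKyr ψ × Equivalent φ ψ))
    × (∀ ψ → IsELKyr ψ → Σ (Form Ag) (λ φ → IsPAFKy φ × Equivalent ψ φ))

module Submission where

-- The witness is  φ₀ = [p] Ky_a K_a p.  We build two S5 knowing-why models on
-- the same two-world frame (worlds true/false, every relation universal,
-- every atom true exactly at world true).  They differ only in their evidence:
-- in the first every formula has evidence everywhere, in the second a formula
-- has evidence at a world exactly when it is true there under the obvious
-- Boolean evaluation ⟦_⟧ of the frame.
--
-- (1) Any evidence assignment through which a Boolean (¬,∧-compositional)
--     valuation is read validates the evidence axioms for Λ and modus ponens.
-- (2) Adequacy: if every ⟦_⟧-true formula has evidence, then ⟦_⟧ computes the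
--     truth of every ELKy^r formula.  Both models qualify, so they agree on
--     all of ℒ_ELKy^r.
-- (3) φ₀ holds at world true of the first model but not of the second: after
--     announcing p only world true survives, yet K_a p is ⟦_⟧-false there.

open import Defs
open import Data.Nat using (ℕ)
open import Data.Product using (Σ; _×_; _,_; proj₁; proj₂)
open import Data.Bool using (Bool; true; false; not; _∧_; _∨_; T)
open import Data.Bool.Properties using (T-≡; T-∧)
open import Data.Unit using (⊤; tt)
open import Function using (id)
open import Relation.Nullary using (¬_)
open import Relation.Binary.PropositionalEquality using (_≡_; refl; sym; trans; cong; cong₂; subst)
open import Relation.Binary.Structures using (IsEquivalence)
open import Function.Definitions using (Injective)
open import Function.Bundles using (_⇔_; mk⇔; Equivalence)

open Equivalence using (to; from)

T-not : ∀ b → T (not b) ⇔ (¬ T b)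
T-not true  = mk⇔ (λ ()) (λ n → n tt)
T-not false = mk⇔ (λ _ ()) (λ _ → tt)

T-implies : ∀ x y → T (not x ∨ y) ⇔ (T x → T y)
T-implies true  y = mk⇔ (λ t _ → t) (λ f → f tt)
T-implies false y = mk⇔ (λ _ ()) (λ _ → tt)

modus-ponensᵇ : ∀ x y → T (not (x ∧ not y)) → T x → T y
modus-ponensᵇ true  true  _  _ = tt
modus-ponensᵇ true  false () _
modus-ponensᵇ false _     _  ()

onBothWorlds : (Bool → Bool) → Bool
onBothWorlds f = f true ∧ f false

T-onBothWorlds : ∀ f → T (onBothWorlds f) ⇔ (∀ w → T (f w))
T-onBothWorlds f = mk⇔ split (λ h → from T-∧ (h true , h false))
  where
  split : T (onBothWorlds f) → ∀ w → T (f w)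
  split t true  = proj₁ (to T-∧ t)
  split t false = proj₂ (to T-∧ t)

module _ {Ag : Set} where

  -- A valuation of all formulas that commutes with ¬ and ∧ (other formulas
  -- are treated as propositional atoms, exactly as in the definition of Λ).
  record IsBoolean (ν : Form Ag → Bool) : Set where
    field
      ν-neg  : ∀ φ → ν (neg φ) ≡ not (ν φ)
      ν-conj : ∀ φ ψ → ν (conj φ ψ) ≡ ν φ ∧ ν ψ

  module _ {ν : Form Ag → Bool} (boolean : IsBoolean ν) where
    open IsBoolean boolean

    pval-self : ∀ φ → pval ν φ ≡ ν φ
    pval-self (var p)     = refl
    pval-self (neg φ)     = trans (cong not (pval-self φ)) (sym (ν-neg φ))
    pval-self (conj φ ψ)  = trans (cong₂ _∧_ (pval-self φ) (pval-self ψ)) (sym (ν-conj φ ψ))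
    pval-self (K a φ)     = refl
    pval-self (Ky a φ)    = refl
    pval-self (Kyr a φ ψ) = refl
    pval-self (ann φ ψ)   = refl

    tautology-true : ∀ φ → Λ φ → T (ν φ)
    tautology-true φ taut = from T-≡ (trans (sym (pval-self φ)) (taut ν))

    modus-ponens : ∀ φ ψ → T (ν (φ ⇒ ψ)) → T (ν φ) → T (ν ψ)
    modus-ponens φ ψ evidence = modus-ponensᵇ (ν φ) (ν ψ) (subst T ν-⇒ evidence)
      where
      ν-⇒ : ν (φ ⇒ ψ) ≡ not (ν φ ∧ not (ν ψ))
      ν-⇒ = trans (ν-neg _) (cong not (trans (ν-conj φ (neg ψ)) (cong (ν φ ∧_) (ν-neg ψ))))

  twoWorlds : (Form Ag → Bool → Set) → Struct {Ag}
  twoWorlds Ev = record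
    { W = Bool ; E = ⊤ ; e = tt ; _·_ = λ _ _ → tt ; R = λ _ _ _ → ⊤
    ; Ev = λ _ χ w → Ev χ w ; V = λ _ w → T w }

  -- Boolean evaluation on that frame; faithful on ℒ_ELKy^r (see `adequacy`).
  -- Ky and announcements are outside that language; their value is arbitrary.
  ⟦_⟧ : Form Ag → Bool → Bool
  ⟦ var p ⟧     w = w
  ⟦ neg φ ⟧     w = not (⟦ φ ⟧ w)
  ⟦ conj φ ψ ⟧  w = ⟦ φ ⟧ w ∧ ⟦ ψ ⟧ w
  ⟦ K a φ ⟧     _ = onBothWorlds ⟦ φ ⟧
  ⟦ Kyr a φ ψ ⟧ _ = onBothWorlds (λ v → not (⟦ φ ⟧ v) ∨ ⟦ ψ ⟧ v)
  ⟦ Ky a φ ⟧    _ = false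
  ⟦ ann φ ψ ⟧   _ = false

  ⟦⟧-boolean : ∀ w → IsBoolean (λ χ → ⟦ χ ⟧ w)
  ⟦⟧-boolean w = record { ν-neg = λ _ → refl ; ν-conj = λ _ _ → refl }

  -- If every ⟦_⟧-true formula has evidence, Ky^r_a(φ,ψ) reduces to
  -- "ψ at every φ-world", and ⟦_⟧ computes truth of every ELKy^r formula.
  module _ (Ev : Form Ag → Bool → Set)
           (evidence-of-truth : ∀ χ w → T (⟦ χ ⟧ w) → Ev χ w) where

    adequacy : ∀ {ψ} → IsELKyr ψ → ∀ w → (twoWorlds Ev , w ⊨ ψ) ⇔ T (⟦ ψ ⟧ w)
    adequacy (var p) w = mk⇔ id id
    adequacy (neg {φ} hφ) w = mk⇔
      (λ ¬φ → from (T-not (⟦ φ ⟧ w)) (λ tφ → ¬φ (from (adequacy hφ w) tφ)))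
      (λ t¬φ sφ → to (T-not (⟦ φ ⟧ w)) t¬φ (to (adequacy hφ w) sφ))
    adequacy (conj hφ hψ) w = mk⇔
      (λ (sφ , sψ) → from T-∧ (to (adequacy hφ w) sφ , to (adequacy hψ w) sψ))
      (λ t → from (adequacy hφ w) (proj₁ (to T-∧ t)) , from (adequacy hψ w) (proj₂ (to T-∧ t)))
    adequacy (K a {φ} hφ) w = mk⇔
      (λ sφ → from (T-onBothWorlds ⟦ φ ⟧) (λ v → to (adequacy hφ v) (sφ v tt)))
      (λ t v _ → from (adequacy hφ v) (to (T-onBothWorlds ⟦ φ ⟧) t v))
    adequacy (Kyr a {φ} {ψ} hφ hψ) w = mk⇔ necessary sufficient
      where
      φ→ψ : Bool → Bool
      φ→ψ v = not (⟦ φ ⟧ v) ∨ ⟦ ψ ⟧ v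

      necessary : twoWorlds Ev , w ⊨ Kyr a φ ψ → T (⟦ Kyr a φ ψ ⟧ w)
      necessary (_ , reason) = from (T-onBothWorlds φ→ψ) λ v →
        from (T-implies (⟦ φ ⟧ v) (⟦ ψ ⟧ v)) λ tφ →
          to (adequacy hψ v) (proj₂ (reason v tt (from (adequacy hφ v) tφ)))

      sufficient : T (⟦ Kyr a φ ψ ⟧ w) → twoWorlds Ev , w ⊨ Kyr a φ ψ
      sufficient t = tt , λ v _ sφ →
        let tψ = to (T-implies (⟦ φ ⟧ v) (⟦ ψ ⟧ v)) (to (T-onBothWorlds φ→ψ) t v)
                    (to (adequacy hφ v) sφ)
        in evidence-of-truth ψ v tψ , from (adequacy hψ v) tψ

  universal-equivalence : IsEquivalence {A = Bool} (λ _ _ → ⊤)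
  universal-equivalence = record { refl = tt ; sym = λ _ → tt ; trans = λ _ _ → tt }

  allEvidence : Form Ag → Bool → Set
  allEvidence _ _ = ⊤

  Mall : Model {Ag}
  Mall = record
    { str = twoWorlds allEvidence ; nonempty = true ; R-equiv = λ _ → universal-equivalence
    ; Ev-Λ = λ _ _ _ → tt ; Ev-mp = λ _ _ _ _ _ _ _ → tt }

  truthEvidence : Form Ag → Bool → Set
  truthEvidence χ w = T (⟦ χ ⟧ w)

  Mtruth : Model {Ag}
  Mtruth = record
    { str = twoWorlds truthEvidence ; nonempty = true ; R-equiv = λ _ → universal-equivalence
    ; Ev-Λ = λ φ taut w → tautology-true (⟦⟧-boolean w) φ taut
    ; Ev-mp = λ _ _ φ ψ w → modus-ponens (⟦⟧-boolean w) φ ψ }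

  ELKyr-invariant : ∀ {ψ} → IsELKyr ψ → ∀ w
                  → twoWorlds allEvidence , w ⊨ ψ → twoWorlds truthEvidence , w ⊨ ψ
  ELKyr-invariant hψ w sψ =
    from (adequacy truthEvidence (λ _ _ → id) hψ w)
         (to (adequacy allEvidence (λ _ _ _ → tt) hψ w) sψ)

  φ₀ : Ag → Form Ag
  φ₀ a = ann (var 0) (Ky a (K a (var 0)))

  φ₀-PAFKy : ∀ a → IsPAFKy (φ₀ a)
  φ₀-PAFKy a = ann (var 0) (Ky a (K a (var 0)))

  φ₀-in-Mall : ∀ a → twoWorlds allEvidence , true ⊨ φ₀ a
  φ₀-in-Mall a _ = (λ _ _ u _ → proj₂ u) , (tt , λ _ _ → tt)

  -- At world true of Mtruth|p, knowing p would need evidence for K_a p,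
  -- but ⟦ K_a p ⟧ is false because p fails at world false.
  φ₀-not-in-Mtruth : ∀ a → ¬ (twoWorlds truthEvidence , true ⊨ φ₀ a)
  φ₀-not-in-Mtruth a announced = proj₂ (proj₂ (announced tt)) (true , tt) tt

  φ₀-undefinable : ∀ a ψ → IsELKyr ψ → ¬ Equivalent (φ₀ a) ψ
  φ₀-undefinable a ψ hψ equivalent =
    φ₀-not-in-Mtruth a (from (equivalent Mtruth true)
      (ELKyr-invariant hψ true (to (equivalent Mall true) (φ₀-in-Mall a))))

  separation⇒not-equally-expressive :
    Σ (Form Ag) (λ φ → IsPAFKy φ × ((ψ : Form Ag) → IsELKyr ψ → ¬ Equivalent φ ψ))
    → ¬ EquallyExpressive-PAFKy-ELKyr {Ag}
  separation⇒not-equally-expressive (φ , hφ , undefinable) (translate , _) =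
    let (ψ , hψ , equivalent) = translate φ hφ in undefinable ψ hψ equivalent

theorem4p5 : (Ag : Set) (enc : Ag → ℕ) → Injective _≡_ _≡_ enc → Ag
    → ¬ EquallyExpressive-PAFKy-ELKyr {Ag}
      × Σ (Form Ag) (λ φ → IsPAFKy φ × ((ψ : Form Ag) → IsELKyr ψ → ¬ Equivalent φ ψ))
theorem4p5 Ag _ _ a = separation⇒not-equally-expressive separation , separation
  where
  separation : Σ (Form Ag) (λ φ → IsPAFKy φ × ((ψ : Form Ag) → IsELKyr ψ → ¬ Equivalent φ ψ))
  separation = φ₀ a , φ₀-PAFKy a , φ₀-undefinable a
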